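{- Let $\mathcal{K}$ be a regular incidence complex of rank $n\ge 1$, let $\Gamma$ be a flag-transitive subgroup of $\Gamma(\mathcal{K})$, let $\Phi=\{F_{ -1},F_0,\dots,F_n\}$ be a flag of $\mathcal{K}$ with $F_i$ of rank $i$, and let $N=\{ -1,0,\dots,n\}$. For $i\in N$ let $R_i=\{\varphi\in\Gamma: F_j\varphi=F_j\text{ for all } j\ne i\}$, and for $I\subseteq N$ let $\Gamma_I=\langle R_i: i\in I\rangle$ if $I\neq\emptyset$ and $\Gamma_\emptyset=R_{ -1}$. Then $\Gamma_I\cap\Gamma_J=\Gamma_{I\cap J}$ for all $I,J\subseteq N$.
   Context: A partially ordered set $\mathcal{K}$ is an incidence complex of rank $n$ if: (I1) it has a least face and a greatest face; (I2) every chain is contained in a maximal chain (flag) with exactly $n+2$ elements (giving a rank function with values $-1,\dots,n$, each flag containing one face of each rank); (I3) every section $G/F=\{H: F\le H\le G\}$ (including $\mathcal{K}$) is connected, where a poset of rank $\le1$ is connected and one of rank $\ge2$ is connected if any two proper faces are joined by a finite sequence of proper faces with consecutive members comparable; (I4) for $i=0,\dots,n-1$, whenever $F<G$ with ranks $i-1$ and $i+1$ there are at least two $i$-faces strictly between them. $\Gamma(\mathcal{K})$ is the group of order-preserving bijections $\mathcal{K}\to\mathcal{K}$ (with order-preserving inverse); $\mathcal{K}$ is regular if $\Gamma(\mathcal{K})$ is transitive on flags; a subgroup $\Gamma\le\Gamma(\mathcal{K})$ is flag-transitive if it is transitive on flags. Automorphisms act on the right. -}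

module Defs where

open import Data.Nat using (ℕ; zero; suc; _+_; _≤_)
open import Data.Fin using (Fin; toℕ)
import Data.Fin as Fin
open import Data.Fin.Subset using (Subset; _∈_; _∩_)
open import Data.Bool using (Bool; true; false; _∨_; if_then_else_)
open import Data.Vec using ([]; _∷_)
open import Data.Product using (Σ; ∃; _×_; _,_)
open import Data.Sum using (_⊎_)
open import Relation.Binary.PropositionalEquality using (_≡_)
open import Relation.Binary.Structures using (IsPartialOrder)
open import Relation.Binary.Construct.Closure.ReflexiveTransitive using (Star)
open import Relation.Nullary using (¬_)

Pred : Set → Set₁
Pred K = K → Set

_⊆ₚ_ : {K : Set} → Pred K → Pred K → Set
P ⊆ₚ Q = ∀ x → P x → Q x

_≐_ : {K : Set} → Pred K → Pred K → Set
P ≐ Q = (P ⊆ₚ Q) × (Q ⊆ₚ P)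

nonempty : ∀ {m} → Subset m → Bool
nonempty [] = false
nonempty (b ∷ v) = b ∨ nonempty v

module _ {K : Set} (_≤ₖ_ : K → K → Set) where

  _<ₖ_ : K → K → Set
  x <ₖ y = (x ≤ₖ y) × ¬ (x ≡ y)

  IsChain : Pred K → Set
  IsChain C = ∀ x y → C x → C y → (x ≤ₖ y) ⊎ (y ≤ₖ x)

  IsFlag : Pred K → Set₁
  IsFlag Φ = IsChain Φ × (∀ D → IsChain D → Φ ⊆ₚ D → D ⊆ₚ Φ)

  EnumeratesChain : (m : ℕ) → (Fin m → K) → Pred K → Set
  EnumeratesChain m f Φ =
    (∀ i j → i Fin.< j → f i <ₖ f j) × (∀ x → Φ x → ∃ λ i → f i ≡ x) × (∀ i → Φ (f i))

  -- a flag of a complex of rank n, enumerated by ranks: f i has rank (toℕ i − 1)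
  FlagEnum : (n : ℕ) → (Fin (suc (suc n)) → K) → Set₁
  FlagEnum n f = ∃ λ Φ → IsFlag Φ × EnumeratesChain (suc (suc n)) f Φ

  -- "F has rank r − 1" (r is the rank shifted by one so that it is a natural number)
  HasRankIdx : (n : ℕ) → K → ℕ → Set₁
  HasRankIdx n F r = ∃ λ f → FlagEnum n f × ∃ λ i → toℕ i ≡ r × f i ≡ F

  Proper : K → K → K → Set
  Proper F G H = (F <ₖ H) × (H <ₖ G)

  Step : K → K → K → K → Set
  Step F G x y = Proper F G x × Proper F G y × ((x ≤ₖ y) ⊎ (y ≤ₖ x))

  SectionConnected : K → K → Set
  SectionConnected F G = ∀ H H' → Proper F G H → Proper F G H' → Star (Step F G) H H'

  record IsIncidenceComplex (n : ℕ) : Set₁ where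
    field
      isPartialOrder : IsPartialOrder _≡_ _≤ₖ_
      least    : ∃ λ F → ∀ x → F ≤ₖ x
      greatest : ∃ λ G → ∀ x → x ≤ₖ G
      chains : ∀ C → IsChain C →
        ∃ λ Φ → IsFlag Φ × C ⊆ₚ Φ × ∃ λ f → EnumeratesChain (suc (suc n)) f Φ
      -- (I3): sections of rank (s − r − 1) ≥ 2 are connected
      connected : ∀ F G r s → F ≤ₖ G → HasRankIdx n F r → HasRankIdx n G s →
        r + 3 ≤ s → SectionConnected F G
      -- (I4): F of rank i−1, G of rank i+1, i = 0..n−1 (r = i)
      diamond : ∀ F G r → suc r ≤ n → F <ₖ G →
        HasRankIdx n F r → HasRankIdx n G (suc (suc r)) →
        ∃ λ H → ∃ λ H' → ¬ (H ≡ H') ×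
          Proper F G H × Proper F G H' ×
          HasRankIdx n H (suc r) × HasRankIdx n H' (suc r)

  record Aut : Set where
    field
      to   : K → K
      from : K → K
      to-from : ∀ x → to (from x) ≡ x
      from-to : ∀ x → from (to x) ≡ x
      to-mono   : ∀ {x y} → x ≤ₖ y → to x ≤ₖ to y
      from-mono : ∀ {x y} → x ≤ₖ y → from x ≤ₖ from y
  open Aut public

  _≈ₐ_ : Aut → Aut → Set
  φ ≈ₐ ψ = ∀ x → to φ x ≡ to ψ x

  idAut : Aut
  idAut = record { to = λ x → x ; from = λ x → x ; to-from = λ _ → Relation.Binary.PropositionalEquality.refl
                 ; from-to = λ _ → Relation.Binary.PropositionalEquality.refl
                 ; to-mono = λ p → p ; from-mono = λ p → p }

  -- product φψ with right action: x(φψ) = (xφ)ψ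
  _·ₐ_ : Aut → Aut → Aut
  φ ·ₐ ψ = record
    { to = λ x → to ψ (to φ x)
    ; from = λ x → from φ (from ψ x)
    ; to-from = λ x → Relation.Binary.PropositionalEquality.trans
        (Relation.Binary.PropositionalEquality.cong (to ψ) (to-from φ (from ψ x))) (to-from ψ x)
    ; from-to = λ x → Relation.Binary.PropositionalEquality.trans
        (Relation.Binary.PropositionalEquality.cong (from φ) (from-to ψ (to φ x))) (from-to φ x)
    ; to-mono = λ p → to-mono ψ (to-mono φ p)
    ; from-mono = λ p → from-mono φ (from-mono ψ p) }

  invAut : Aut → Aut
  invAut φ = record { to = from φ ; from = to φ ; to-from = from-to φ ; from-to = to-from φ
                    ; to-mono = from-mono φ ; from-mono = to-mono φ }

  _▹_ : Pred K → Aut → Pred K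
  (Φ ▹ φ) y = ∃ λ x → Φ x × to φ x ≡ y

  record IsSubgroup (Γ : Aut → Set) : Set where
    field
      resp : ∀ {φ ψ} → φ ≈ₐ ψ → Γ φ → Γ ψ
      has-id : Γ idAut
      has-· : ∀ {φ ψ} → Γ φ → Γ ψ → Γ (φ ·ₐ ψ)
      has-inv : ∀ {φ} → Γ φ → Γ (invAut φ)

  IsRegular : Set₁
  IsRegular = ∀ Φ Ψ → IsFlag Φ → IsFlag Ψ → ∃ λ (φ : Aut) → (Φ ▹ φ) ≐ Ψ

  FlagTransitive : (Aut → Set) → Set₁
  FlagTransitive Γ = ∀ Φ Ψ → IsFlag Φ → IsFlag Ψ → ∃ λ φ → Γ φ × (Φ ▹ φ) ≐ Ψ

  data Gen (S : Aut → Set) : Aut → Set where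
    gen  : ∀ {φ} → S φ → Gen S φ
    gid  : Gen S idAut
    gmul : ∀ {φ ψ} → Gen S φ → Gen S ψ → Gen S (φ ·ₐ ψ)
    ginv : ∀ {φ} → Gen S φ → Gen S (invAut φ)
    gresp : ∀ {φ ψ} → φ ≈ₐ ψ → Gen S φ → Gen S ψ

  module _ {n : ℕ} (Γ : Aut → Set) (F : Fin (suc (suc n)) → K) where
    -- R_i = {φ ∈ Γ : F_j φ = F_j for all j ≠ i}; index i ↔ rank i − 1
    R : Fin (suc (suc n)) → Aut → Set
    R i φ = Γ φ × (∀ j → ¬ (j ≡ i) → to φ (F j) ≡ F j)

    ΓI : Subset (suc (suc n)) → Aut → Set
    ΓI I φ = if nonempty I then Gen (λ ψ → ∃ λ i → i ∈ I × R i ψ) φ else R Fin.zero φ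

module Submission where

-- Write N = n + 2 for the number of faces of a flag, F 0 < … < F (N-1) for the
-- base flag, and Stab I = {φ ∈ Γ : F j φ = F j for all j ∉ I}.  The theorem
-- follows from the identity  Γ_I = Stab I,  because Stab (I ∩ J) is visibly
-- Stab I ∩ Stab J.  The inclusion Γ_I ⊆ Stab I holds as Stab I is a subgroup
-- containing the generators; the converse is the heart of the matter.
--
-- Then, for I omitting
-- both ends, Stab I ⊆ ⟨R_i : i ∈ I⟩ is proved by induction on |I|: pick a
-- maximal run a < p < b of indices with (a,b) ⊆ I and a, b ∉ I.  Walking
-- through the (connected) section F a / F b and realising each step by
-- flag-transitivity, one finds γ ∈ ⟨R_i : i ∈ I⟩ with F p γ = F p φ; then
-- φγ⁻¹ ∈ Stab (I - p), which lies in ⟨R_i : i ∈ I - p⟩ by induction.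

open import Defs
open import Data.Nat using (ℕ; suc; _≤_)
open import Data.Fin using (Fin)
open import Data.Fin.Subset using (Subset; _∩_)
open import Data.Product using (_×_)

import Data.Nat as ℕ
import Data.Nat.Properties as ℕₚ
open import Data.Nat.Induction using (<-wellFounded)
open import Data.Fin using (zero; suc; toℕ; fromℕ; fromℕ<; inject; inject₁; pinch)
  renaming (_<_ to _<ᶠ_; _≤_ to _≤ᶠ_)
import Data.Fin.Properties as Finₚ
open import Data.Fin.Subset using (_∈_; _∉_; _⊆_; _-_; ∣_∣; Nonempty; Empty)
open import Data.Fin.Subset.Properties
  using (_∈?_; nonempty?; x∈p∩q⁺; p∩q⊆p; p∩q⊆q; p─q⊆p; x∈p⇒∣p-x∣<∣p∣; x∈p∧x≢y⇒x∈p-y)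
open import Data.Bool using (true; false)
open import Data.Vec using (_∷_)
open import Data.Vec.Base using (here; there)
open import Data.Product using (∃; _,_; proj₁; proj₂)
open import Data.Sum using (_⊎_; inj₁; inj₂; swap)
open import Data.Empty using (⊥; ⊥-elim)
open import Function using (_∘_)
open import Induction.WellFounded using (module All)
import Relation.Binary.Construct.On as On
open import Relation.Binary.Bundles using (Poset)
import Relation.Binary.Properties.Poset as PosetProperties
open import Relation.Binary.Definitions using (tri<; tri≈; tri>)
open import Relation.Binary.PropositionalEquality using (_≡_; refl; sym; trans; cong; subst; subst₂)
open import Relation.Binary.Construct.Closure.ReflexiveTransitive using (Star; ε; _◅_)
open import Relation.Nullary using (¬_; Dec; yes; no; ¬?)
open import Relation.Nullary.Decidable using (decidable-stable; _→-dec_)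

nonempty-true : ∀ {m} (I : Subset m) → nonempty I ≡ true → Nonempty I
nonempty-true (true ∷ I)  _ = zero , here
nonempty-true (false ∷ I) e with nonempty-true I e
... | i , i∈I = suc i , there i∈I

nonempty-false : ∀ {m} (I : Subset m) → nonempty I ≡ false → Empty I
nonempty-false (false ∷ I) e (suc i , there i∈I) = nonempty-false I e (i , i∈I)

leastFailure : ∀ {m} (P : Fin m → Set) → (∀ j → Dec (P j)) → ∀ i → ¬ P i →
  ∃ λ b → ¬ P b × (∀ j → j <ᶠ b → P j)
leastFailure {m} P P? i ¬Pi with Finₚ.¬∀⟶∃¬-smallest m P P? (λ all → ¬Pi (all i))
... | b , ¬Pb , below = b , ¬Pb , λ j j<b → subst P (injectBack j j<b) (below (fromℕ< j<b))
  where
  injectBack : ∀ j (j<b : j <ᶠ b) → inject {i = b} (fromℕ< j<b) ≡ j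
  injectBack j j<b = Finₚ.toℕ-injective (trans (Finₚ.toℕ-inject _) (Finₚ.toℕ-fromℕ< j<b))

x∉p-x : ∀ {m} (I : Subset m) x → x ∉ I - x
x∉p-x (_ ∷ I) (suc x) (there x∈I-x) = x∉p-x I x x∈I-x

predecessor : ∀ {m} (p : Fin (suc m)) → ¬ (p ≡ zero) → ∃ λ (a : Fin (suc m)) → suc (toℕ a) ≡ toℕ p
predecessor zero    p≢0 = ⊥-elim (p≢0 refl)
predecessor (suc p) _   = inject₁ p , cong suc (Finₚ.toℕ-inject₁ p)

record Run {m} (I : Subset m) : Set where
  field
    a p b : Fin m
    a<p : a <ᶠ p
    p<b : p <ᶠ b
    a∉I : a ∉ I
    b∉I : b ∉ I
    between∈I : ∀ j → a <ᶠ j → j <ᶠ b → j ∈ I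

-- A nonempty set of indices omitting both ends contains a maximal run: start
-- at its least element p, and end at the first non-element above p.
findRun : ∀ {m} (I : Subset (suc m)) → Nonempty I → zero ∉ I → fromℕ m ∉ I → Run I
findRun {m} I (i , i∈I) zero∉I last∉I = run
  where
  least = leastFailure (_∉ I) (λ j → ¬? (j ∈? I)) i (λ i∉I → i∉I i∈I)
  p = proj₁ least
  p∈I : p ∈ I
  p∈I = decidable-stable (p ∈? I) (proj₁ (proj₂ least))
  p<last : p <ᶠ fromℕ m
  p<last = Finₚ.≤∧≢⇒< (Finₚ.≤fromℕ p) (λ p≡last → last∉I (subst (_∈ I) p≡last p∈I))
  above = leastFailure (λ j → p <ᶠ j → j ∈ I) (λ j → (p Finₚ.<? j) →-dec (j ∈? I)) _
            (λ h → last∉I (h p<last))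
  b = proj₁ above
  p<b : p <ᶠ b
  p<b with p Finₚ.<? b
  ... | yes p<b = p<b
  ... | no p≮b = ⊥-elim (proj₁ (proj₂ above) (λ p<b → ⊥-elim (p≮b p<b)))
  pred-p = predecessor p (λ p≡0 → zero∉I (subst (_∈ I) p≡0 p∈I))
  a = proj₁ pred-p
  a<p : a <ᶠ p
  a<p = ℕₚ.≤-reflexive (proj₂ pred-p)
  below-p⇒≤a : ∀ j → j <ᶠ p → j ≤ᶠ a
  below-p⇒≤a j j<p = ℕₚ.≤-pred (subst (toℕ j ℕ.<_) (sym (proj₂ pred-p)) j<p)
  between : ∀ j → a <ᶠ j → j <ᶠ b → j ∈ I
  between j a<j j<b with Finₚ.<-cmp p j
  ... | tri< p<j _ _ = proj₂ (proj₂ above) j j<b p<j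
  ... | tri≈ _ p≡j _ = subst (_∈ I) p≡j p∈I
  ... | tri> _ _ j<p = ⊥-elim (ℕₚ.<⇒≱ a<j (below-p⇒≤a j j<p))
  run : Run I
  run = record
    { a = a ; p = p ; b = b ; a<p = a<p ; p<b = p<b
    ; a∉I = proj₂ (proj₂ least) a a<p
    ; b∉I = λ b∈I → proj₁ (proj₂ above) (λ _ → b∈I)
    ; between∈I = between }


module _ {K : Set} {_≤ₖ_ : K → K → Set} where

  Gen-least : ∀ {P Q : Pred (Aut _≤ₖ_)} → IsSubgroup _≤ₖ_ Q → P ⊆ₚ Q → Gen _≤ₖ_ P ⊆ₚ Q
  Gen-least subQ P⊆Q φ (gen Pφ) = P⊆Q φ Pφ
  Gen-least subQ P⊆Q _ gid = IsSubgroup.has-id subQ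
  Gen-least subQ P⊆Q _ (gmul g h) = IsSubgroup.has-· subQ (Gen-least subQ P⊆Q _ g) (Gen-least subQ P⊆Q _ h)
  Gen-least subQ P⊆Q _ (ginv g) = IsSubgroup.has-inv subQ (Gen-least subQ P⊆Q _ g)
  Gen-least subQ P⊆Q _ (gresp e g) = IsSubgroup.resp subQ e (Gen-least subQ P⊆Q _ g)

  Gen-mono : ∀ {P Q : Pred (Aut _≤ₖ_)} → P ⊆ₚ Q → Gen _≤ₖ_ P ⊆ₚ Gen _≤ₖ_ Q
  Gen-mono P⊆Q φ (gen Pφ) = gen (P⊆Q φ Pφ)
  Gen-mono P⊆Q _ gid = gid
  Gen-mono P⊆Q _ (gmul g h) = gmul (Gen-mono P⊆Q _ g) (Gen-mono P⊆Q _ h)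
  Gen-mono P⊆Q _ (ginv g) = ginv (Gen-mono P⊆Q _ g)
  Gen-mono P⊆Q _ (gresp e g) = gresp e (Gen-mono P⊆Q _ g)


toℕ-pinch-≤ : ∀ {m} (s : Fin m) k → toℕ k ℕ.≤ toℕ s → toℕ (pinch s k) ≡ toℕ k
toℕ-pinch-≤ zero    zero    _ = refl
toℕ-pinch-≤ (suc s) zero    _ = refl
toℕ-pinch-≤ (suc s) (suc k) (ℕ.s≤s k≤s) = cong suc (toℕ-pinch-≤ s k k≤s)

toℕ-pinch-> : ∀ {m} (s : Fin m) k → toℕ s ℕ.< toℕ k → suc (toℕ (pinch s k)) ≡ toℕ k
toℕ-pinch-> zero    (suc k) _ = refl
toℕ-pinch-> (suc s) (suc k) (ℕ.s≤s s<k) = cong suc (toℕ-pinch-> s k s<k)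

pinch-above : ∀ {m} (s : Fin m) k → toℕ s ℕ.< toℕ k → s ≤ᶠ pinch s k
pinch-above s k s<k = ℕₚ.≤-pred (subst (toℕ s ℕ.<_) (sym (toℕ-pinch-> s k s<k)) s<k)

module Complex {K : Set} (_≤ₖ_ : K → K → Set) (n : ℕ) (IC : IsIncidenceComplex _≤ₖ_ n) where

  open IsIncidenceComplex IC

  poset : Poset _ _ _
  poset = record { isPartialOrder = isPartialOrder }

  open Poset poset using (antisym) renaming (refl to ≤ₖ-refl; trans to ≤ₖ-trans)
  open PosetProperties poset using (<-irrefl; <-asym)
  open import Relation.Binary.Reasoning.PartialOrder poset

  _⊏_ : K → K → Set
  _⊏_ = _<ₖ_ _≤ₖ_

  N : ℕ
  N = suc (suc n)

  Increasing : ∀ {m} → (Fin m → K) → Set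
  Increasing f = ∀ i j → i <ᶠ j → f i ⊏ f j

  module _ {m} {f : Fin m → K} (inc : Increasing f) where

    increasing-monotone : ∀ {i j} → i ≤ᶠ j → f i ≤ₖ f j
    increasing-monotone {i} {j} i≤j with Finₚ.<-cmp i j
    ... | tri< i<j _ _ = proj₁ (inc i j i<j)
    ... | tri≈ _ refl _ = ≤ₖ-refl
    ... | tri> _ _ j<i = ⊥-elim (ℕₚ.<-irrefl refl (ℕₚ.≤-<-trans i≤j j<i))

    increasing-reflects : ∀ {i j} → f i ⊏ f j → i <ᶠ j
    increasing-reflects {i} {j} fi<fj with Finₚ.<-cmp i j
    ... | tri< i<j _ _ = i<j
    ... | tri≈ _ refl _ = ⊥-elim (<-irrefl refl fi<fj)
    ... | tri> _ _ j<i = ⊥-elim (<-asym fi<fj (inc j i j<i))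

    increasing-injective : ∀ {i j} → f i ≡ f j → i ≡ j
    increasing-injective {i} {j} fi≡fj with Finₚ.<-cmp i j
    ... | tri< i<j _ _ = ⊥-elim (<-irrefl fi≡fj (inc i j i<j))
    ... | tri≈ _ i≡j _ = i≡j
    ... | tri> _ _ j<i = ⊥-elim (<-irrefl (sym fi≡fj) (inc j i j<i))

  increasing-aut : ∀ {m} {f : Fin m → K} → Increasing f → (φ : Aut _≤ₖ_) → Increasing (to φ ∘ f)
  increasing-aut inc φ i j i<j =
    to-mono φ (proj₁ (inc i j i<j)) ,
    λ e → proj₂ (inc i j i<j) (trans (sym (from-to φ _)) (trans (cong (from φ) e) (from-to φ _)))

  -- By (I2) every chain lies in a flag with N faces, so no chain has N + 1 faces:
  -- sending each face of the chain to its position in such a flag would be an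
  -- injection Fin (N + 1) → Fin N.
  noLongChain : (c : Fin (suc N) → K) → Increasing c → ⊥
  noLongChain c inc =
    let (_ , _ , C⊆Ψ , e , _ , e-covers , _) = chains C C-chain
        slot : Fin (suc N) → Fin N
        slot k = proj₁ (e-covers (c k) (C⊆Ψ (c k) (k , refl)))
        e-slot : ∀ k → e (slot k) ≡ c k
        e-slot k = proj₂ (e-covers (c k) (C⊆Ψ (c k) (k , refl)))
        slot-injective : ∀ {k k′} → slot k ≡ slot k′ → k ≡ k′
        slot-injective {k} {k′} same = increasing-injective inc
          (trans (sym (e-slot k)) (trans (cong e same) (e-slot k′)))
    in ℕₚ.<-irrefl refl (Finₚ.injective⇒≤ slot-injective)
    where
    C : Pred K
    C x = ∃ λ k → c k ≡ x
    C-chain : IsChain _≤ₖ_ C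
    C-chain _ _ (k , refl) (k′ , refl) with Finₚ.≤-total k k′
    ... | inj₁ k≤k′ = inj₁ (increasing-monotone inc k≤k′)
    ... | inj₂ k′≤k = inj₂ (increasing-monotone inc k′≤k)

  -- If g t = h s with t < s then h₀ < … < h_s = g_t < g_s < … < g_{N-1}
  -- would be a chain of N + 1 faces.
  shiftedPositionImpossible : ∀ {g h : Fin N → K} → Increasing g → Increasing h →
    ∀ {t s} → g t ≡ h s → t <ᶠ s → ⊥
  shiftedPositionImpossible {g} {h} g-inc h-inc {t} {s} gt≡hs t<s = noLongChain c c-inc
    where
    c : Fin (suc N) → K
    c k with toℕ k ℕ.≤? toℕ s
    ... | yes _ = h (pinch s k)
    ... | no _  = g (pinch s k)
    c-inc : Increasing c
    c-inc k k′ k<k′ with toℕ k ℕ.≤? toℕ s | toℕ k′ ℕ.≤? toℕ s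
    ... | yes k≤s | yes k′≤s = h-inc _ _
          (subst₂ ℕ._<_ (sym (toℕ-pinch-≤ s k k≤s)) (sym (toℕ-pinch-≤ s k′ k′≤s)) k<k′)
    ... | yes k≤s | no k′≰s = begin-strict
          h (pinch s k)  ≤⟨ increasing-monotone h-inc (subst (ℕ._≤ toℕ s) (sym (toℕ-pinch-≤ s k k≤s)) k≤s) ⟩
          h s            ≡⟨ sym gt≡hs ⟩
          g t            <⟨ g-inc t s t<s ⟩
          g s            ≤⟨ increasing-monotone g-inc (pinch-above s k′ (ℕₚ.≰⇒> k′≰s)) ⟩
          g (pinch s k′) ∎
    ... | no k≰s  | yes k′≤s = ⊥-elim (k≰s (ℕₚ.≤-trans (ℕₚ.<⇒≤ k<k′) k′≤s))
    ... | no k≰s  | no k′≰s = g-inc _ _ (ℕₚ.≤-pred (subst₂ ℕ._<_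
          (sym (toℕ-pinch-> s k (ℕₚ.≰⇒> k≰s))) (sym (toℕ-pinch-> s k′ (ℕₚ.≰⇒> k′≰s))) k<k′))

  -- Positions in flags are ranks: two increasing enumerations of N faces that
  -- share a face list it at the same position.
  rank-unique : ∀ {g h : Fin N → K} → Increasing g → Increasing h →
    ∀ {t s} → g t ≡ h s → t ≡ s
  rank-unique g-inc h-inc {t} {s} gt≡hs with Finₚ.<-cmp t s
  ... | tri< t<s _ _ = ⊥-elim (shiftedPositionImpossible g-inc h-inc gt≡hs t<s)
  ... | tri≈ _ t≡s _ = t≡s
  ... | tri> _ _ s<t = ⊥-elim (shiftedPositionImpossible h-inc g-inc (sym gt≡hs) s<t)

  flag-absorbs : ∀ {Φ} → IsFlag _≤ₖ_ Φ → ∀ x → (∀ y → Φ y → (x ≤ₖ y) ⊎ (y ≤ₖ x)) → Φ x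
  flag-absorbs {Φ} (Φ-chain , Φ-maximal) x comparable =
    Φ-maximal Φ+x Φ+x-chain (λ _ → inj₁) x (inj₂ refl)
    where
    Φ+x : Pred K
    Φ+x y = Φ y ⊎ y ≡ x
    Φ+x-chain : IsChain _≤ₖ_ Φ+x
    Φ+x-chain y z (inj₁ Φy) (inj₁ Φz) = Φ-chain y z Φy Φz
    Φ+x-chain y _ (inj₁ Φy) (inj₂ refl) = swap (comparable y Φy)
    Φ+x-chain _ z (inj₂ refl) (inj₁ Φz) = comparable z Φz
    Φ+x-chain _ _ (inj₂ refl) (inj₂ refl) = inj₁ ≤ₖ-refl

  aut-fixes-least : ∀ (φ : Aut _≤ₖ_) {L} → (∀ x → L ≤ₖ x) → to φ L ≡ L
  aut-fixes-least φ {L} L-least = antisym (begin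
    to φ L          ≤⟨ to-mono φ (L-least (from φ L)) ⟩
    to φ (from φ L) ≡⟨ to-from φ L ⟩
    L               ∎) (L-least (to φ L))

  aut-fixes-greatest : ∀ (φ : Aut _≤ₖ_) {G} → (∀ x → x ≤ₖ G) → to φ G ≡ G
  aut-fixes-greatest φ {G} G-greatest = antisym (G-greatest (to φ G)) (begin
    G               ≡⟨ to-from φ G ⟨
    to φ (from φ G) ≤⟨ to-mono φ (G-greatest (from φ G)) ⟩
    to φ G          ∎)


  module Flagged (Γ : Aut _≤ₖ_ → Set) (Γ-subgroup : IsSubgroup _≤ₖ_ Γ)
    (Γ-transitive : FlagTransitive _≤ₖ_ Γ) (F : Fin N → K) (F-flag : FlagEnum _≤ₖ_ n F) where

    open IsSubgroup Γ-subgroup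

    Φ₀ : Pred K
    Φ₀ = proj₁ F-flag

    Φ₀-flag : IsFlag _≤ₖ_ Φ₀
    Φ₀-flag = proj₁ (proj₂ F-flag)

    F-increasing : Increasing F
    F-increasing = proj₁ (proj₂ (proj₂ F-flag))

    F-covers : ∀ x → Φ₀ x → ∃ λ i → F i ≡ x
    F-covers = proj₁ (proj₂ (proj₂ (proj₂ F-flag)))

    F-monotone : ∀ {i j} → i ≤ᶠ j → F i ≤ₖ F j
    F-monotone = increasing-monotone F-increasing

    F-comparable : ∀ i j → (F i ≤ₖ F j) ⊎ (F j ≤ₖ F i)
    F-comparable i j with Finₚ.≤-total i j
    ... | inj₁ i≤j = inj₁ (F-monotone i≤j)
    ... | inj₂ j≤i = inj₂ (F-monotone j≤i)

    last : Fin N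
    last = fromℕ (suc n)

    -- The base flag contains the least and the greatest face, so these are its ends.
    F-least : ∀ x → F zero ≤ₖ x
    F-least x with F-covers _ (flag-absorbs Φ₀-flag _ (λ y _ → inj₁ (proj₂ least y)))
    ... | i , Fi≡L = ≤ₖ-trans (F-monotone {zero} {i} ℕ.z≤n)
                       (subst (_≤ₖ x) (sym Fi≡L) (proj₂ least x))

    F-greatest : ∀ x → x ≤ₖ F last
    F-greatest x with F-covers _ (flag-absorbs Φ₀-flag _ (λ y _ → inj₂ (proj₂ greatest y)))
    ... | i , Fi≡G = ≤ₖ-trans (subst (x ≤ₖ_) (sym Fi≡G) (proj₂ greatest x))
                       (F-monotone (Finₚ.≤fromℕ i))

    realize : ∀ C → IsChain _≤ₖ_ C → ∃ λ δ → Γ δ × (∀ x → C x → ∃ λ i → to δ (F i) ≡ x)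
    realize C C-chain with chains C C-chain
    ... | Ψ , Ψ-flag , C⊆Ψ , _ with Γ-transitive Φ₀ Ψ Φ₀-flag Ψ-flag
    ... | δ , δ∈Γ , _ , Ψ⊆Φ₀δ = δ , δ∈Γ , onto
      where
      onto : ∀ x → C x → ∃ λ i → to δ (F i) ≡ x
      onto x Cx with Ψ⊆Φ₀δ x (C⊆Ψ x Cx)
      ... | y , Φ₀y , δy≡x with F-covers y Φ₀y
      ... | i , refl = i , δy≡x

    Outside : Fin N → Fin N → Fin N → Set
    Outside a b j = j ≤ᶠ a ⊎ b ≤ᶠ j

    realizeInSection : ∀ a b (X : Pred K) → IsChain _≤ₖ_ X → (∀ x → X x → Proper _≤ₖ_ (F a) (F b) x) →
      ∃ λ δ → Γ δ × (∀ j → Outside a b j → to δ (F j) ≡ F j) × (∀ x → X x → ∃ λ i → to δ (F i) ≡ x)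
    realizeInSection a b X X-chain X-proper with realize C C-chain
      where
      C : Pred K
      C y = (∃ λ j → Outside a b j × F j ≡ y) ⊎ X y
      outside-comparable : ∀ j → Outside a b j → ∀ x → X x → (F j ≤ₖ x) ⊎ (x ≤ₖ F j)
      outside-comparable j (inj₁ j≤a) x Xx = inj₁ (≤ₖ-trans (F-monotone j≤a) (proj₁ (proj₁ (X-proper x Xx))))
      outside-comparable j (inj₂ b≤j) x Xx = inj₂ (≤ₖ-trans (proj₁ (proj₂ (X-proper x Xx))) (F-monotone b≤j))
      C-chain : IsChain _≤ₖ_ C
      C-chain _ _ (inj₁ (i , _ , refl)) (inj₁ (j , _ , refl)) = F-comparable i j
      C-chain _ y (inj₁ (j , out , refl)) (inj₂ Xy) = outside-comparable j out y Xy
      C-chain x _ (inj₂ Xx) (inj₁ (j , out , refl)) = swap (outside-comparable j out x Xx)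
      C-chain x y (inj₂ Xx) (inj₂ Xy) = X-chain x y Xx Xy
    ... | δ , δ∈Γ , onto = δ , δ∈Γ , fixes , λ x Xx → onto x (inj₂ Xx)
      where
      fixes : ∀ j → Outside a b j → to δ (F j) ≡ F j
      fixes j out with onto (F j) (inj₁ (j , out , refl))
      ... | i , δFi≡Fj with rank-unique (increasing-aut F-increasing δ) F-increasing δFi≡Fj
      ... | refl = δFi≡Fj

    Stab : Subset N → Aut _≤ₖ_ → Set
    Stab I φ = Γ φ × (∀ j → j ∉ I → to φ (F j) ≡ F j)

    Stab-subgroup : ∀ I → IsSubgroup _≤ₖ_ (Stab I)
    Stab-subgroup I = record
      { resp = λ { φ≈ψ (φ∈Γ , fix) → resp φ≈ψ φ∈Γ , λ j j∉I → trans (sym (φ≈ψ (F j))) (fix j j∉I) }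
      ; has-id = has-id , λ _ _ → refl
      ; has-· = λ { {φ} {ψ} (φ∈Γ , φ-fix) (ψ∈Γ , ψ-fix) →
          has-· φ∈Γ ψ∈Γ , λ j j∉I → trans (cong (to ψ) (φ-fix j j∉I)) (ψ-fix j j∉I) }
      ; has-inv = λ { {φ} (φ∈Γ , fix) →
          has-inv φ∈Γ , λ j j∉I → trans (cong (from φ) (sym (fix j j∉I))) (from-to φ (F j)) } }

    Stab-mono : ∀ {I J} → I ⊆ J → Stab I ⊆ₚ Stab J
    Stab-mono I⊆J φ (φ∈Γ , fix) = φ∈Γ , λ j j∉J → fix j (j∉J ∘ I⊆J)

    Stab-∩ : ∀ I J → Stab I ⊆ₚ (λ φ → Stab J φ → Stab (I ∩ J) φ)
    Stab-∩ I J φ (φ∈Γ , fixI) (_ , fixJ) = φ∈Γ , fix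
      where
      fix : ∀ j → j ∉ I ∩ J → to φ (F j) ≡ F j
      fix j j∉I∩J with j ∈? I
      ... | yes j∈I = fixJ j (λ j∈J → j∉I∩J (x∈p∩q⁺ (j∈I , j∈J)))
      ... | no j∉I  = fixI j j∉I

    -- R′ i is the subgroup R_{i-1} of the statement, for the base flag F
    R′ : Fin N → Aut _≤ₖ_ → Set
    R′ = R _≤ₖ_ Γ F

    -- R_{-1} fixes the whole base flag (F zero is fixed anyway, being least).
    R₀-fixes-all : ∀ {ψ} → R′ zero ψ → ∀ j → to ψ (F j) ≡ F j
    R₀-fixes-all {ψ} _     zero    = aut-fixes-least ψ F-least
    R₀-fixes-all (_ , fix) (suc j) = fix (suc j) (λ ())

    R⇒Stab : ∀ {I i} → i ∈ I → R′ i ⊆ₚ Stab I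
    R⇒Stab {I} i∈I ψ (ψ∈Γ , fix) = ψ∈Γ , λ j j∉I → fix j (λ { refl → j∉I i∈I })

    R₀⇒Stab : ∀ I → R′ zero ⊆ₚ Stab I
    R₀⇒Stab I ψ ψ∈R₀@(ψ∈Γ , _) = ψ∈Γ , λ j _ → R₀-fixes-all ψ∈R₀ j

    -- ⟨I⟩ = ⟨R_{-1}, R_i : i ∈ I⟩, a form of Γ_I that is defined uniformly in I.
    Generators : Subset N → Aut _≤ₖ_ → Set
    Generators I ψ = R′ zero ψ ⊎ ∃ λ i → i ∈ I × R′ i ψ

    ⟨_⟩ : Subset N → Aut _≤ₖ_ → Set
    ⟨ I ⟩ = Gen _≤ₖ_ (Generators I)

    ⟨⟩-mono : ∀ {I J} → I ⊆ J → ⟨ I ⟩ ⊆ₚ ⟨ J ⟩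
    ⟨⟩-mono I⊆J = Gen-mono λ { ψ (inj₁ ψ∈R₀) → inj₁ ψ∈R₀ ; ψ (inj₂ (i , i∈I , ψ∈Rᵢ)) → inj₂ (i , I⊆J i∈I , ψ∈Rᵢ) }

    ⟨⟩⊆Stab : ∀ I → ⟨ I ⟩ ⊆ₚ Stab I
    ⟨⟩⊆Stab I = Gen-least (Stab-subgroup I)
      λ { ψ (inj₁ ψ∈R₀) → R₀⇒Stab I ψ ψ∈R₀ ; ψ (inj₂ (i , i∈I , ψ∈Rᵢ)) → R⇒Stab i∈I ψ ψ∈Rᵢ }

    -- Exchange: if δ ∈ Stab I agrees on F p (p ∈ I) with some ρ ∈ ⟨I⟩, then
    -- δρ⁻¹ ∈ Stab (I - p); hence δ ∈ ⟨I⟩ as soon as Stab (I - p) ⊆ ⟨I - p⟩.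
    exchange : ∀ I {p} → p ∈ I → Stab (I - p) ⊆ₚ ⟨ I - p ⟩ →
      ∀ {δ ρ} → Stab I δ → ⟨ I ⟩ ρ → to δ (F p) ≡ to ρ (F p) → ⟨ I ⟩ δ
    exchange I {p} p∈I induction {δ} {ρ} (δ∈Γ , δ-fix) ρ∈⟨I⟩ δp≡ρp =
      gresp (λ x → to-from ρ (to δ x))
        (gmul (⟨⟩-mono (p─q⊆p I _) _ (induction δρ⁻¹ δρ⁻¹∈Stab)) ρ∈⟨I⟩)
      where
      δρ⁻¹ : Aut _≤ₖ_
      δρ⁻¹ = _·ₐ_ _≤ₖ_ δ (invAut _≤ₖ_ ρ)
      ρ-stab = ⟨⟩⊆Stab I ρ ρ∈⟨I⟩
      fix : ∀ j → j ∉ I - p → from ρ (to δ (F j)) ≡ F j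
      fix j j∉I-p with j Finₚ.≟ p
      ... | yes refl = trans (cong (from ρ) δp≡ρp) (from-to ρ (F p))
      ... | no j≢p = trans (cong (from ρ) (trans (δ-fix j j∉I) (sym (proj₂ ρ-stab j j∉I)))) (from-to ρ (F j))
        where
        j∉I : j ∉ I
        j∉I j∈I = j∉I-p (x∈p∧x≢y⇒x∈p-y j∈I j≢p)
      δρ⁻¹∈Stab : Stab (I - p) δρ⁻¹
      δρ⁻¹∈Stab = has-· δ∈Γ (has-inv (proj₁ ρ-stab)) , fix

    Reached : Subset N → K → Set
    Reached I H = ∃ λ γ → ⟨ I ⟩ γ × ∃ λ q → to γ (F q) ≡ H

    module InRun (I : Subset N) (run : Run I)
      (induction : ∀ {q} → q ∈ I → Stab (I - q) ⊆ₚ ⟨ I - q ⟩) where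

      open Run run

      Section : K → Set
      Section = Proper _≤ₖ_ (F a) (F b)

      outside-or-between : ∀ j → Outside a b j ⊎ (a <ᶠ j × j <ᶠ b)
      outside-or-between j with ℕₚ.≤-<-connex (toℕ j) (toℕ a)
      ... | inj₁ j≤a = inj₁ (inj₁ j≤a)
      ... | inj₂ a<j with ℕₚ.<-≤-connex (toℕ j) (toℕ b)
      ... | inj₁ j<b = inj₂ (a<j , j<b)
      ... | inj₂ b≤j = inj₁ (inj₂ b≤j)

      outside : ∀ j → j ∉ I → Outside a b j
      outside j j∉I with outside-or-between j
      ... | inj₁ out = out
      ... | inj₂ (a<j , j<b) = ⊥-elim (j∉I (between∈I j a<j j<b))

      realizeInRun : ∀ X → IsChain _≤ₖ_ X → (∀ x → X x → Section x) →
        ∃ λ δ → Stab I δ × (∀ x → X x → ∃ λ i → to δ (F i) ≡ x)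
      realizeInRun X X-chain X-sec with realizeInSection a b X X-chain X-sec
      ... | δ , δ∈Γ , fix , onto = δ , (δ∈Γ , λ j j∉I → fix j (outside j j∉I)) , onto

      Stab-section : ∀ {φ q} → Stab I φ → a <ᶠ q → q <ᶠ b → Section (to φ (F q))
      Stab-section {φ} {q} (_ , fix) a<q q<b =
        subst (_⊏ to φ (F q)) (fix a a∉I) (increasing-aut F-increasing φ a q a<q) ,
        subst (to φ (F q) ⊏_) (fix b b∉I) (increasing-aut F-increasing φ q b q<b)

      section⇒run : ∀ {φ q} → Stab I φ → Section (to φ (F q)) → q ∈ I
      section⇒run {φ} {q} (_ , fix) (Fa<φq , φq<Fb) = between∈I q
        (increasing-reflects (increasing-aut F-increasing φ) (subst (_⊏ to φ (F q)) (sym (fix a a∉I)) Fa<φq))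
        (increasing-reflects (increasing-aut F-increasing φ) (subst (to φ (F q) ⊏_) (sym (fix b b∉I)) φq<Fb))

      -- Along a step x ~ y of the section, realise {x, y} by some δ ∈ Stab I;
      -- δ agrees on some F q with the element of ⟨I⟩ reaching x, so δ ∈ ⟨I⟩.
      reached-step : ∀ {x y} → Step _≤ₖ_ (F a) (F b) x y → Reached I x → Reached I y
      reached-step {x} {y} (x-sec , y-sec , x~y) (γ , γ∈⟨I⟩ , q , γq≡x)
        with realizeInRun X X-chain X-sec
        where
        X : Pred K
        X z = z ≡ x ⊎ z ≡ y
        X-chain : IsChain _≤ₖ_ X
        X-chain _ _ (inj₁ refl) (inj₁ refl) = inj₁ ≤ₖ-refl
        X-chain _ _ (inj₁ refl) (inj₂ refl) = x~y
        X-chain _ _ (inj₂ refl) (inj₁ refl) = swap x~y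
        X-chain _ _ (inj₂ refl) (inj₂ refl) = inj₁ ≤ₖ-refl
        X-sec : ∀ z → X z → Section z
        X-sec _ (inj₁ refl) = x-sec
        X-sec _ (inj₂ refl) = y-sec
      ... | δ , δ-stab , onto with onto x (inj₁ refl)
      ... | i , δi≡x with rank-unique (increasing-aut F-increasing δ) (increasing-aut F-increasing γ)
                            (trans δi≡x (sym γq≡x))
      ... | refl = δ , δ∈⟨I⟩ , onto y (inj₂ refl)
        where
        q∈I : q ∈ I
        q∈I = section⇒run (⟨⟩⊆Stab I γ γ∈⟨I⟩) (subst Section (sym γq≡x) x-sec)
        δ∈⟨I⟩ : ⟨ I ⟩ δ
        δ∈⟨I⟩ = exchange I q∈I (induction q∈I) δ-stab γ∈⟨I⟩ (trans δi≡x (sym γq≡x))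

      reached-path : ∀ {x y} → Star (Step _≤ₖ_ (F a) (F b)) x y → Reached I x → Reached I y
      reached-path ε         reached = reached
      reached-path (s ◅ ss) reached = reached-path ss (reached-step s reached)

      narrow-run : ¬ (toℕ a ℕ.+ 3 ≤ toℕ b) → ∀ j → a <ᶠ j → j <ᶠ b → j ≡ p
      narrow-run narrow j a<j j<b = Finₚ.toℕ-injective (trans (next-to-a j a<j j<b) (sym (next-to-a p a<p p<b)))
        where
        b≤a+2 : toℕ b ≤ suc (suc (toℕ a))
        b≤a+2 = ℕₚ.≤-pred (subst (toℕ b ℕ.<_) (ℕₚ.+-comm (toℕ a) 3) (ℕₚ.≰⇒> narrow))
        next-to-a : ∀ k → a <ᶠ k → k <ᶠ b → toℕ k ≡ suc (toℕ a)
        next-to-a k a<k k<b = ℕₚ.≤-antisym (ℕₚ.≤-pred (ℕₚ.<-≤-trans k<b b≤a+2)) a<k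

      -- Every proper face of the section is reached: for a section of rank ≥ 2
      -- walk from F p along a path given by (I3); for rank 1 the realising
      -- element lies in R_p itself.
      reached-section : ∀ {y} → Section y → Reached I y
      reached-section {y} y-sec with toℕ a ℕ.+ 3 ℕ.≤? toℕ b
      ... | yes wide = reached-path path (idAut _≤ₖ_ , gid , p , refl)
        where
        path = connected (F a) (F b) (toℕ a) (toℕ b) (F-monotone (ℕₚ.<⇒≤ (ℕₚ.<-trans a<p p<b)))
                 (F , F-flag , a , refl , refl) (F , F-flag , b , refl , refl) wide
                 (F p) y (F-increasing a p a<p , F-increasing p b p<b) y-sec
      ... | no narrow with realizeInSection a b (_≡ y) (λ { _ _ refl refl → inj₁ ≤ₖ-refl }) (λ { _ refl → y-sec })
      ... | δ , δ∈Γ , fix , onto = δ , gen (inj₂ (p , between∈I p a<p p<b , δ∈Γ , fixes)) , onto y refl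
        where
        fixes : ∀ j → ¬ (j ≡ p) → to δ (F j) ≡ F j
        fixes j j≢p with outside-or-between j
        ... | inj₁ out = fix j out
        ... | inj₂ (a<j , j<b) = ⊥-elim (j≢p (narrow-run narrow j a<j j<b))

      -- F p φ is reached, and by rank-unique it is reached from F p itself.
      move : ∀ φ → Stab I φ → ∃ λ γ → ⟨ I ⟩ γ × to γ (F p) ≡ to φ (F p)
      move φ φ-stab with reached-section (Stab-section φ-stab a<p p<b)
      ... | γ , γ∈⟨I⟩ , q , γq≡φp with rank-unique (increasing-aut F-increasing γ) (increasing-aut F-increasing φ) γq≡φp
      ... | refl = γ , γ∈⟨I⟩ , γq≡φp

    -- For nonempty I a maximal run (a,p,b) gives γ ∈ ⟨I⟩ with F p γ = F p φ
    -- (InRun.move, using the claim for the sets I - q); exchange then finishes.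
    Stab⊆⟨⟩-inner : ∀ I → zero ∉ I → last ∉ I → Stab I ⊆ₚ ⟨ I ⟩
    Stab⊆⟨⟩-inner = All.wfRec (On.wellFounded ∣_∣ <-wellFounded) _ Claim step
      where
      Claim : Subset N → Set
      Claim I = zero ∉ I → last ∉ I → Stab I ⊆ₚ ⟨ I ⟩
      step : ∀ I → (∀ {I′} → ∣ I′ ∣ ℕ.< ∣ I ∣ → Claim I′) → Claim I
      step I smaller zero∉I last∉I φ φ-stab with nonempty? I
      ... | no I=∅ = gen (inj₁ (proj₁ φ-stab , λ j _ → proj₂ φ-stab j (λ j∈I → I=∅ (j , j∈I))))
      ... | yes I≠∅ = exchange I p∈I (induction p∈I) φ-stab γ∈⟨I⟩ (sym γp≡φp)
        where
        induction : ∀ {q} → q ∈ I → Stab (I - q) ⊆ₚ ⟨ I - q ⟩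
        induction q∈I = smaller (x∈p⇒∣p-x∣<∣p∣ q∈I) (zero∉I ∘ p─q⊆p I _) (last∉I ∘ p─q⊆p I _)
        run = findRun I I≠∅ zero∉I last∉I
        open Run run using (p; a<p; p<b; between∈I)
        open InRun I run induction using (move)
        p∈I = between∈I p a<p p<b
        moved = move φ φ-stab
        γ∈⟨I⟩ = proj₁ (proj₂ moved)
        γp≡φp = proj₂ (proj₂ moved)

    -- Every automorphism fixes F zero and F last, so these indices may be
    -- dropped from I before applying the core induction.
    Stab⊆⟨⟩ : ∀ I → Stab I ⊆ₚ ⟨ I ⟩
    Stab⊆⟨⟩ I φ (φ∈Γ , fix) =
      ⟨⟩-mono (p─q⊆p I _ ∘ p─q⊆p (I - zero) _) φ (Stab⊆⟨⟩-inner inner zero∉ last∉ φ (φ∈Γ , fix′))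
      where
      inner = I - zero - last
      zero∉ : zero ∉ inner
      zero∉ = x∉p-x I zero ∘ p─q⊆p (I - zero) _
      last∉ : last ∉ inner
      last∉ = x∉p-x (I - zero) last
      fix′ : ∀ j → j ∉ inner → to φ (F j) ≡ F j
      fix′ j j∉inner with j Finₚ.≟ zero | j Finₚ.≟ last
      ... | yes refl | _        = aut-fixes-least φ F-least
      ... | no _     | yes refl = aut-fixes-greatest φ F-greatest
      ... | no j≢0   | no j≢last = fix j (λ j∈I → j∉inner (x∈p∧x≢y⇒x∈p-y (x∈p∧x≢y⇒x∈p-y j∈I j≢0) j≢last))

    -- Γ_I = Stab I: the inclusion ⊆ since Stab I is a subgroup containing the
    -- generators, the inclusion ⊇ by Stab⊆⟨⟩ (R_{-1} ⊆ R_i absorbs the extra generators).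
    ΓI⇒Stab : ∀ I → ΓI _≤ₖ_ Γ F I ⊆ₚ Stab I
    ΓI⇒Stab I φ φ∈ΓI with nonempty I
    ... | true  = Gen-least (Stab-subgroup I) (λ { ψ (i , i∈I , ψ∈Rᵢ) → R⇒Stab i∈I ψ ψ∈Rᵢ }) φ φ∈ΓI
    ... | false = R₀⇒Stab I φ φ∈ΓI

    Stab⇒ΓI : ∀ I → Stab I ⊆ₚ ΓI _≤ₖ_ Γ F I
    Stab⇒ΓI I φ φ-stab with nonempty I in I-test
    ... | true = Gen-mono generator φ (Stab⊆⟨⟩ I φ φ-stab)
      where
      i₀ = nonempty-true I I-test
      -- R_{-1} ⊆ R_i for every i, in particular for some i ∈ I
      generator : Generators I ⊆ₚ (λ ψ → ∃ λ i → i ∈ I × R′ i ψ)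
      generator ψ (inj₁ ψ∈R₀) = proj₁ i₀ , proj₂ i₀ , proj₁ ψ∈R₀ , λ j _ → R₀-fixes-all ψ∈R₀ j
      generator ψ (inj₂ ψ∈Rᵢ) = ψ∈Rᵢ
    ... | false = proj₁ φ-stab , λ j _ → proj₂ φ-stab j (λ j∈I → nonempty-false I I-test (j , j∈I))

-- Lemma 3.3: Γ_I ∩ Γ_J = Γ_{I ∩ J}, since Γ_I = Stab I and Stab (I ∩ J) = Stab I ∩ Stab J.
lemma3p3 : {K : Set} (_≤ₖ_ : K → K → Set) (n : ℕ) → 1 ≤ n →
    IsIncidenceComplex _≤ₖ_ n → IsRegular _≤ₖ_ →
    (Γ : Aut _≤ₖ_ → Set) → IsSubgroup _≤ₖ_ Γ → FlagTransitive _≤ₖ_ Γ →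
    (F : Fin (suc (suc n)) → K) → FlagEnum _≤ₖ_ n F →
    (I J : Subset (suc (suc n))) → (φ : Aut _≤ₖ_) →
    ((ΓI _≤ₖ_ Γ F I φ × ΓI _≤ₖ_ Γ F J φ) → ΓI _≤ₖ_ Γ F (I ∩ J) φ) ×
    (ΓI _≤ₖ_ Γ F (I ∩ J) φ → ΓI _≤ₖ_ Γ F I φ × ΓI _≤ₖ_ Γ F J φ)
lemma3p3 _≤ₖ_ n _ complex _ Γ Γ-subgroup Γ-transitive F F-flag I J φ =
  (λ (φ∈ΓI , φ∈ΓJ) → Stab⇒ΓI (I ∩ J) φ (Stab-∩ I J φ (ΓI⇒Stab I φ φ∈ΓI) (ΓI⇒Stab J φ φ∈ΓJ))) ,
  (λ φ∈ΓI∩J → let φ-stab = ΓI⇒Stab (I ∩ J) φ φ∈ΓI∩J in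
    Stab⇒ΓI I φ (Stab-mono (p∩q⊆p I J) φ φ-stab) , Stab⇒ΓI J φ (Stab-mono (p∩q⊆q I J) φ φ-stab))
  where
  open Complex.Flagged _≤ₖ_ n complex Γ Γ-subgroup Γ-transitive F F-flag
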